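{- Let $G$ be a finite graph (without loops or multiple edges) with no isolated vertices, having $|G|$ vertices, and suppose there exists no nontrivial circuit injection $f: G_M\to B$ with $B$ a binary matroid. If $|G|=2N$ is even, then $G$ is Hamiltonian. If $|G|=2N+1$ is odd, then $G$ is almost Hamiltonian.
   Context: $G_M$ denotes the cycle matroid of $G$: its cells are the edges of $G$ and its circuits are the circuits (cycles, as edge sets) of $G$. A matroid $\{S,\mathscr{C}\}$ is given by its cell set and circuit family. It is binary if for all $A,B\in\mathscr{C}$, $A\oplus B=(A\cup B)\setminus(A\cap B)$ is a union of pairwise disjoint circuits. A circuit injection $f:\{S,\mathscr{C}\}\to\{S',\mathscr{C}'\}$ is a bijection $S\to S'$ mapping every member of $\mathscr{C}$ to a member of $\mathscr{C}'$; it is nontrivial if some member of $\mathscr{C}'$ is not the image of a member of $\mathscr{C}$. $G$ is Hamiltonian if it has a circuit through all vertices. A graph of order $n$ is almost Hamiltonian if every set of $n-1$ of its vertices is contained in (the vertex set of) some circuit. -}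

module Defs where

open import Data.Nat using (ℕ; zero; suc; _≤_; _<?_)
open import Data.Fin using (Fin; toℕ; fromℕ<)
open import Data.Fin.Subset using (Subset; _∈_; _⊆_; _∪_; _∩_; _─_; ⊥; ⁅_⁆)
open import Data.List using (List; foldr)
open import Data.List.Relation.Unary.All using (All)
open import Data.List.Relation.Unary.AllPairs using (AllPairs)
open import Data.Product using (Σ; ∃; _×_; _,_)
open import Data.Sum using (_⊎_)
open import Relation.Nullary using (¬_; yes; no)
open import Relation.Binary.PropositionalEquality using (_≡_; _≢_)
open import Function.Bundles using (Bijection; _⤖_)
open import Function.Definitions using (Injective)
open import Function.Bundles using (_⇔_)

record Graph (n : ℕ) : Set where
  field
    m        : ℕ
    src tgt  : Fin m → Fin n
    loopless : ∀ e → src e ≢ tgt e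

  Joins : Fin m → Fin n → Fin n → Set
  Joins e u v = (src e ≡ u × tgt e ≡ v) ⊎ (src e ≡ v × tgt e ≡ u)

  field
    simple   : ∀ e e' → Joins e' (src e) (tgt e) → e ≡ e'

open Graph public

NoIsolated : ∀ {n} → Graph n → Set
NoIsolated {n} G = ∀ (u : Fin n) → ∃ λ e → src G e ≡ u ⊎ tgt G e ≡ u

next : ∀ {k} → Fin (suc k) → Fin (suc k)
next {k} i with suc (toℕ i) <? suc k
... | yes p = fromℕ< p
... | no _  = Fin.zero

record Circ {n} (G : Graph n) : Set where
  field
    k      : ℕ
    long   : 2 ≤ k                   -- i.e. at least 3 vertices
    v      : Fin (suc k) → Fin n
    v-inj  : Injective _≡_ _≡_ v
    step   : ∀ i → ∃ λ e → Joins G e (v i) (v (next i))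

  InEdges : Fin (m G) → Set
  InEdges e = ∃ λ i → Joins G e (v i) (v (next i))

open Circ public

-- C is a circuit of the cycle matroid G_M: the edge set of a cycle.
IsGraphCircuit : ∀ {n} (G : Graph n) → Subset (m G) → Set
IsGraphCircuit G C = ∃ λ (c : Circ G) → ∀ e → (e ∈ C) ⇔ InEdges c e

record Matroid (s : ℕ) : Set₁ where
  field
    IsCircuit : Subset s → Set
    nonempty  : ¬ IsCircuit ⊥
    minimal   : ∀ {A B} → IsCircuit A → IsCircuit B → A ⊆ B → A ≡ B
    elim      : ∀ {A B x} → IsCircuit A → IsCircuit B → A ≢ B → x ∈ A → x ∈ B →
                ∃ λ C → IsCircuit C × C ⊆ ((A ∪ B) ─ ⁅ x ⁆)

open Matroid public

_⊕_ : ∀ {s} → Subset s → Subset s → Subset s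
A ⊕ B = (A ∪ B) ─ (A ∩ B)

UnionOfDisjointCircuits : ∀ {s} → Matroid s → Subset s → Set
UnionOfDisjointCircuits {s} M A =
  ∃ λ (Ds : List (Subset s)) →
    All (IsCircuit M) Ds × AllPairs (λ X Y → X ∩ Y ≡ ⊥) Ds × A ≡ foldr _∪_ ⊥ Ds

IsBinary : ∀ {s} → Matroid s → Set
IsBinary M = ∀ {A B} → IsCircuit M A → IsCircuit M B → UnionOfDisjointCircuits M (A ⊕ B)

IsImage : ∀ {a b} → (Fin a → Fin b) → Subset a → Subset b → Set
IsImage {a} f C D = (∀ (x : Fin a) → x ∈ C ⇔ f x ∈ D) × (∀ y → y ∈ D → ∃ λ x → f x ≡ y)

record CircuitInjection {n} (G : Graph n) {s} (B : Matroid s) : Set where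
  field
    f       : Fin (m G) ⤖ Fin s
    maps    : ∀ C → IsGraphCircuit G C →
              ∃ λ D → IsImage (Bijection.to f) C D × IsCircuit B D

Nontrivial : ∀ {n} {G : Graph n} {s} {B : Matroid s} → CircuitInjection G B → Set
Nontrivial {G = G} {B = B} ι =
  ∃ λ D → IsCircuit B D ×
    ¬ (∃ λ C → IsGraphCircuit G C × IsImage (Bijection.to (CircuitInjection.f ι)) C D)

Hamiltonian : ∀ {n} → Graph n → Set
Hamiltonian {n} G = ∃ λ (c : Circ G) → ∀ (u : Fin n) → ∃ λ i → v c i ≡ u

-- every set of n-1 vertices (= all vertices but one, w) lies on a circuit
AlmostHamiltonian : ∀ {n} → Graph n → Set
AlmostHamiltonian {n} G =
  ∀ (w : Fin n) → ∃ λ (c : Circ G) → ∀ (u : Fin n) → u ≢ w → ∃ λ i → v c i ≡ u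

module Submission where

open import Defs
open import Data.Nat using (ℕ; suc; _*_; _+_)
open import Data.Product using (_×_; ∃)
open import Relation.Nullary using (¬_)
open import Relation.Binary.PropositionalEquality using (_≡_)

-- We work over GF(2): edge sets and vertex sets are Boolean vectors with
-- symmetric difference ⊕ as addition, and the boundary ∂ y of an edge set y
-- is the set of vertices of odd degree in y.  A boundary is a set T = ∂ y.
--  (1) The minimal nonempty members of a decidable ⊕-closed family of subsets
--      are the circuits of a binary matroid (module BinaryFromSubspace).
--  (2) Key lemma (covered): every nonempty boundary T lies on a circuit of G.
--      Otherwise the edge sets with boundary ∅ or T form such a family; each
--      cycle of G is minimal in it (a T-join inside a cycle would put T on the
--      cycle), and a minimal T-join is a further circuit that is no cycle, so
--      the identity is a nontrivial circuit injection into a binary matroid.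
--  (3) Hence any two vertices u, w are linked, i.e. {u, w} is a boundary: a
--      circuit through the ends of edges at u and at w contains u and w.
--  (4) Summing {u, w} over all vertices u gives a boundary containing every
--      vertex except possibly w, and also w when |G| is even; a circuit
--      through it, given by (2), is the required (almost) Hamiltonian circuit.

open import Algebra.Bundles using (CommutativeMonoid; CommutativeRing)
open import Data.Bool.Base using (Bool; true; false; not; _∧_; _xor_)
open import Data.Bool.Properties as Bool
  using (xor-comm; xor-assoc; xor-same; xor-identityˡ; xor-identityʳ; ¬-not;
         ∧-distribʳ-xor; ∧-identityʳ; ∧-zeroʳ)
open import Algebra.Properties.CommutativeMonoid.Sum
    (CommutativeRing.+-commutativeMonoid Bool.xor-∧-commutativeRing)
  using (sum; sum-cong-≗; ∑-distrib-+; sum-remove; sum-replicate; sum-replicate-zero)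
open import Algebra.Properties.Monoid.Mult
    (CommutativeMonoid.monoid (CommutativeRing.+-commutativeMonoid Bool.xor-∧-commutativeRing))
  using (×-assocˡ) renaming (_×_ to _times_)
open import Data.Fin.Base as Fin using (Fin; toℕ; fromℕ; punchIn; punchOut; finToFun; funToFin)
open import Data.Fin.Properties
  using (_≟_; any?; all?; toℕ-injective; toℕ-fromℕ<; toℕ-fromℕ; toℕ<n; punchInᵢ≢i;
         punchIn-injective; punchIn-punchOut; finToFun-funToFin; injective⇒≤)
open import Data.Fin.Subset using (Subset; _∈_; _∉_; _⊆_; _⊂_; _∪_; _∩_; _─_; _-_; ⊥; ⁅_⁆; ⋃; Nonempty)
open import Data.Fin.Subset.Properties
  using (_⊂?_; _∈?_; anySubset?; ⊆-refl; ⊆-trans; ⊆-antisym; p⊂q⇒p⊆q; p─q⊆p; p⊆p∪q; q⊆p∪q;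
         x∈p∪q⁻; x∈p∩q⁻; x∈p∩q⁺; x∈p∧x∉q⇒x∈p─q; x∈p∧x≢y⇒x∈p-y; p∩q≢∅⇒p─q⊂p;
         Empty-unique; nonempty?; ∉⊥; x∈⁅x⁆; x∈⁅y⁆⇒x≡y)
open import Data.Fin.Subset.Induction using (⊂-wellFounded)
open import Data.List.Base using (List; []; _∷_)
open import Data.List.Relation.Unary.All as All using (All; []; _∷_)
open import Data.List.Relation.Unary.AllPairs using ([]; _∷_)
open import Data.Nat.Base using (zero; _<_; _≤_; _∸_; s≤s; z≤n; z<s)
import Data.Nat.Properties as ℕ
open import Data.Product using (_,_; proj₁; proj₂)
open import Data.Sum using (_⊎_; inj₁; inj₂; swap)
open import Data.Vec.Base using ([]; _∷_; lookup; tabulate; zipWith)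
open import Data.Vec.Properties
  using (≡-dec; []=⇒lookup; lookup⇒[]=; lookup∘tabulate; lookup-replicate; lookup-zipWith;
         tabulate∘lookup; tabulate-cong; zipWith-assoc; zipWith-comm; zipWith-identityˡ; zipWith-identityʳ)
open import Function.Base using (_∘_; id)
open import Function.Bundles using (_⇔_; Equivalence; mk⇔)
open import Function.Construct.Identity using (⤖-id)
open import Function.Definitions using (Injective)
open import Induction.WellFounded using (Acc; acc)
open import Relation.Nullary using (Dec; yes; no; ¬?; does; contradiction)
open import Relation.Nullary.Decidable using (_×-dec_; _⊎-dec_; _→-dec_; map′; dec-true; dec-false)
open import Relation.Unary using (Decidable)
open import Relation.Binary.PropositionalEquality
  using (refl; sym; trans; cong; cong₂; subst; subst₂; _≢_; _≗_; module ≡-Reasoning)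
open ≡-Reasoning

∈⇒true : ∀ {s} {x : Fin s} {p : Subset s} → x ∈ p → lookup p x ≡ true
∈⇒true = []=⇒lookup

true⇒∈ : ∀ {s} {x : Fin s} {p : Subset s} → lookup p x ≡ true → x ∈ p
true⇒∈ {x = x} {p} = lookup⇒[]= x p

∉⇒false : ∀ {s} {x : Fin s} {p : Subset s} → x ∉ p → lookup p x ≡ false
∉⇒false x∉p = ¬-not (x∉p ∘ true⇒∈)

subset-ext : ∀ {s} {A B : Subset s} → (∀ i → lookup A i ≡ lookup B i) → A ≡ B
subset-ext {A = A} {B} same =
  trans (sym (tabulate∘lookup A)) (trans (tabulate-cong same) (tabulate∘lookup B))

_≟ˢ_ : ∀ {s} (A B : Subset s) → Dec (A ≡ B)
_≟ˢ_ = ≡-dec Bool._≟_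

lookup-⊥ : ∀ {s} (i : Fin s) → lookup ⊥ i ≡ false
lookup-⊥ i = lookup-replicate i false

lookup-─ : ∀ {s} (A B : Subset s) i → lookup (A ─ B) i ≡ lookup A i ∧ not (lookup B i)
lookup-─ (a ∷ A) (true  ∷ B) Fin.zero    = sym (∧-zeroʳ a)
lookup-─ (a ∷ A) (false ∷ B) Fin.zero    = sym (∧-identityʳ a)
lookup-─ (a ∷ A) (b     ∷ B) (Fin.suc i) = lookup-─ A B i

_==_ : ∀ {a} → Fin a → Fin a → Bool
i == j = does (i ≟ j)

lookup-⁅⁆ : ∀ {a} (i j : Fin a) → lookup ⁅ i ⁆ j ≡ (i == j)
lookup-⁅⁆ i j with i ≟ j
... | yes refl = ∈⇒true (x∈⁅x⁆ i)
... | no i≢j   = ∉⇒false (λ j∈⁅i⁆ → i≢j (sym (x∈⁅y⁆⇒x≡y i j∈⁅i⁆)))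

==-refl : ∀ {a} (i : Fin a) → (i == i) ≡ true
==-refl i = dec-true (i ≟ i) refl

xor-false⇒≡ : ∀ {a b} → a xor b ≡ false → a ≡ b
xor-false⇒≡ {true}  {true}  _ = refl
xor-false⇒≡ {false} {false} _ = refl

⊕-is-xor : ∀ {s} (A B : Subset s) → A ⊕ B ≡ zipWith _xor_ A B
⊕-is-xor []          []          = refl
⊕-is-xor (true  ∷ A) (true  ∷ B) = cong (false ∷_) (⊕-is-xor A B)
⊕-is-xor (true  ∷ A) (false ∷ B) = cong (true  ∷_) (⊕-is-xor A B)
⊕-is-xor (false ∷ A) (true  ∷ B) = cong (true  ∷_) (⊕-is-xor A B)
⊕-is-xor (false ∷ A) (false ∷ B) = cong (false ∷_) (⊕-is-xor A B)

lookup-⊕ : ∀ {s} (A B : Subset s) i → lookup (A ⊕ B) i ≡ lookup A i xor lookup B i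
lookup-⊕ A B i = trans (cong (λ X → lookup X i) (⊕-is-xor A B)) (lookup-zipWith _xor_ i A B)

⊕-assoc : ∀ {s} (A B C : Subset s) → (A ⊕ B) ⊕ C ≡ A ⊕ (B ⊕ C)
⊕-assoc A B C = begin
  (A ⊕ B) ⊕ C                          ≡⟨ ⊕-is-xor (A ⊕ B) C ⟩
  zipWith _xor_ (A ⊕ B) C              ≡⟨ cong (λ X → zipWith _xor_ X C) (⊕-is-xor A B) ⟩
  zipWith _xor_ (zipWith _xor_ A B) C  ≡⟨ zipWith-assoc xor-assoc A B C ⟩
  zipWith _xor_ A (zipWith _xor_ B C)  ≡⟨ cong (zipWith _xor_ A) (⊕-is-xor B C) ⟨
  zipWith _xor_ A (B ⊕ C)              ≡⟨ ⊕-is-xor A (B ⊕ C) ⟨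
  A ⊕ (B ⊕ C)                          ∎

⊕-comm : ∀ {s} (A B : Subset s) → A ⊕ B ≡ B ⊕ A
⊕-comm A B = trans (⊕-is-xor A B) (trans (zipWith-comm xor-comm A B) (sym (⊕-is-xor B A)))

⊕-identityˡ : ∀ {s} (A : Subset s) → ⊥ ⊕ A ≡ A
⊕-identityˡ A = trans (⊕-is-xor ⊥ A) (zipWith-identityˡ xor-identityˡ A)

⊕-identityʳ : ∀ {s} (A : Subset s) → A ⊕ ⊥ ≡ A
⊕-identityʳ A = trans (⊕-is-xor A ⊥) (zipWith-identityʳ xor-identityʳ A)

⊕-self : ∀ {s} (A : Subset s) → A ⊕ A ≡ ⊥
⊕-self A = subset-ext λ i → trans (lookup-⊕ A A i) (trans (xor-same (lookup A i)) (sym (lookup-⊥ i)))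

⊕≡⊥⇒≡ : ∀ {s} {A B : Subset s} → A ⊕ B ≡ ⊥ → A ≡ B
⊕≡⊥⇒≡ {A = A} {B} A⊕B≡⊥ = begin
  A            ≡⟨ ⊕-identityʳ A ⟨
  A ⊕ ⊥        ≡⟨ cong (A ⊕_) (⊕-self B) ⟨
  A ⊕ (B ⊕ B)  ≡⟨ ⊕-assoc A B B ⟨
  (A ⊕ B) ⊕ B  ≡⟨ cong (_⊕ B) A⊕B≡⊥ ⟩
  ⊥ ⊕ B        ≡⟨ ⊕-identityˡ B ⟩
  B            ∎

∈─⇒∉ : ∀ {s} {A B : Subset s} {x} → x ∈ A ─ B → x ∉ B
∈─⇒∉ {A = A} {B} {x} x∈A─B x∈B = contradiction entry λ ()
  where
    entry : true ≡ false
    entry = begin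
      true                            ≡⟨ ∈⇒true x∈A─B ⟨
      lookup (A ─ B) x                ≡⟨ lookup-─ A B x ⟩
      lookup A x ∧ not (lookup B x)   ≡⟨ cong (λ b → lookup A x ∧ not b) (∈⇒true x∈B) ⟩
      lookup A x ∧ false              ≡⟨ ∧-zeroʳ (lookup A x) ⟩
      false                           ∎

─≡⊕ : ∀ {s} {A B : Subset s} → B ⊆ A → A ─ B ≡ A ⊕ B
─≡⊕ {A = A} {B} B⊆A = subset-ext λ i →
  trans (lookup-─ A B i) (trans (bool (lookup A i) (lookup B i) (∈⇒true ∘ B⊆A ∘ true⇒∈)) (sym (lookup-⊕ A B i)))
  where
    bool : ∀ a b → (b ≡ true → a ≡ true) → a ∧ not b ≡ a xor b
    bool true  true  _ = refl
    bool true  false _ = refl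
    bool false false _ = refl
    bool false true  b⇒a = contradiction (b⇒a refl) λ ()

∪─-split : ∀ {s} {A B : Subset s} → B ⊆ A → A ≡ B ∪ (A ─ B)
∪─-split {A = A} {B} B⊆A = ⊆-antisym split merge
  where
    split : A ⊆ B ∪ (A ─ B)
    split {x} x∈A with x ∈? B
    ... | yes x∈B = p⊆p∪q (A ─ B) x∈B
    ... | no  x∉B = q⊆p∪q B (A ─ B) (x∈p∧x∉q⇒x∈p─q x∈A x∉B)
    merge : B ∪ (A ─ B) ⊆ A
    merge {x} x∈ with x∈p∪q⁻ B (A ─ B) x∈
    ... | inj₁ x∈B   = B⊆A x∈B
    ... | inj₂ x∈A─B = p─q⊆p A B x∈A─B

─-fixed⇒⊥ : ∀ {s} {C D : Subset s} → D ⊆ C → C ─ D ≡ C → D ≡ ⊥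
─-fixed⇒⊥ {C = C} {D} D⊆C C─D≡C =
  Empty-unique λ (x , x∈D) → ∈─⇒∉ (subst (x ∈_) (sym C─D≡C) (D⊆C x∈D)) x∈D

≢⊥⇒nonempty : ∀ {s} {A : Subset s} → A ≢ ⊥ → Nonempty A
≢⊥⇒nonempty {A = A} A≢⊥ with nonempty? A
... | yes nonempty = nonempty
... | no  empty    = contradiction (Empty-unique empty) A≢⊥

─-disjoint : ∀ {s} {A B Y : Subset s} → Y ⊆ A ─ B → B ∩ Y ≡ ⊥
─-disjoint {B = B} {Y} Y⊆A─B = Empty-unique λ (x , x∈B∩Y) →
  let x∈B , x∈Y = x∈p∩q⁻ B Y x∈B∩Y in ∈─⇒∉ (Y⊆A─B x∈Y) x∈B

⊕⊆∪-minus : ∀ {s} {A B : Subset s} {x} → x ∈ A → x ∈ B → A ⊕ B ⊆ (A ∪ B) - x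
⊕⊆∪-minus {A = A} {B} x∈A x∈B {y} y∈A⊕B =
  x∈p∧x≢y⇒x∈p-y (p─q⊆p (A ∪ B) (A ∩ B) y∈A⊕B)
                 λ { refl → ∈─⇒∉ y∈A⊕B (x∈p∩q⁺ (x∈A , x∈B)) }

⋃-upper : ∀ {s} (Ds : List (Subset s)) → All (_⊆ ⋃ Ds) Ds
⋃-upper []       = []
⋃-upper (D ∷ Ds) = p⊆p∪q (⋃ Ds) ∷ All.map (λ Y⊆⋃Ds {x} x∈Y → q⊆p∪q D (⋃ Ds) (Y⊆⋃Ds x∈Y)) (⋃-upper Ds)

Σ-zero : ∀ {a} (f : Fin a → Bool) → (∀ i → f i ≡ false) → sum f ≡ false
Σ-zero {a} f vanishes = trans (sum-cong-≗ vanishes) (sum-replicate-zero a)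

Σ-single : ∀ {a} (f : Fin a → Bool) p → (∀ i → i ≢ p → f i ≡ false) → sum f ≡ f p
Σ-single {suc a} f p off = begin
  sum f                           ≡⟨ sum-remove {i = p} f ⟩
  f p xor sum (f ∘ punchIn p)     ≡⟨ cong (f p xor_) (Σ-zero (f ∘ punchIn p) (λ j → off _ (punchInᵢ≢i p j))) ⟩
  f p xor false                   ≡⟨ xor-identityʳ (f p) ⟩
  f p                             ∎

Σ-pair : ∀ {a} (f : Fin a → Bool) {p q} → p ≢ q → (∀ i → i ≢ p → i ≢ q → f i ≡ false) →
         sum f ≡ f p xor f q
Σ-pair {suc a} f {p} {q} p≢q off = begin
  sum f                        ≡⟨ sum-remove {i = p} f ⟩
  f p xor sum (f ∘ punchIn p)  ≡⟨ cong (f p xor_) (Σ-single (f ∘ punchIn p) q′ off′) ⟩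
  f p xor f (punchIn p q′)     ≡⟨ cong (λ i → f p xor f i) (punchIn-punchOut p≢q) ⟩
  f p xor f q                  ∎
  where
    q′ = punchOut p≢q
    off′ : ∀ j → j ≢ q′ → f (punchIn p j) ≡ false
    off′ j j≢q′ = off _ (punchInᵢ≢i p j)
      λ j↦q → j≢q′ (punchIn-injective p j q′ (trans j↦q (sym (punchIn-punchOut p≢q))))

Σ-const-even : ∀ M b → sum {2 * M} (λ _ → b) ≡ false
Σ-const-even M b = begin
  sum {2 * M} (λ _ → b)                    ≡⟨ sum-replicate (2 * M) ⟩
  (2 * M) times b                          ≡⟨ ×-assocˡ b 2 M ⟨
  (M times b) xor ((M times b) xor false)  ≡⟨ cong ((M times b) xor_) (xor-identityʳ (M times b)) ⟩
  (M times b) xor (M times b)              ≡⟨ xor-same (M times b) ⟩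
  false                                    ∎

⨁ : ∀ {a s} → (Fin a → Subset s) → Subset s
⨁ {zero}  F = ⊥
⨁ {suc a} F = F Fin.zero ⊕ ⨁ (F ∘ Fin.suc)

lookup-⨁ : ∀ {a s} (F : Fin a → Subset s) x → lookup (⨁ F) x ≡ sum (λ i → lookup (F i) x)
lookup-⨁ {zero}  F x = lookup-⊥ x
lookup-⨁ {suc a} F x =
  trans (lookup-⊕ (F Fin.zero) (⨁ (F ∘ Fin.suc)) x) (cong (lookup (F Fin.zero) x xor_) (lookup-⨁ (F ∘ Fin.suc) x))

MinimalWith : ∀ {s} → (Subset s → Set) → Subset s → Set
MinimalWith P C = P C × (∀ D → P D → D ⊆ C → D ≡ C)

⊆∧⊄⇒≡ : ∀ {s} {C D : Subset s} → D ⊆ C → ¬ (D ⊂ C) → D ≡ C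
⊆∧⊄⇒≡ {D = D} D⊆C D⊄C = ⊆-antisym D⊆C C⊆D
  where
    C⊆D : _ ⊆ D
    C⊆D {x} x∈C with x ∈? D
    ... | yes x∈D = x∈D
    ... | no  x∉D = contradiction ((λ {z} → D⊆C {z}) , x , x∈C , x∉D) D⊄C

minimal-below : ∀ {s} {P : Subset s → Set} → Decidable P →
                ∀ {y} → P y → ∃ λ C → MinimalWith P C × C ⊆ y
minimal-below {P = P} P? {y} Py = descend y (⊂-wellFounded y) Py
  where
    descend : ∀ y → Acc _⊂_ y → P y → ∃ λ C → MinimalWith P C × C ⊆ y
    descend y (acc smaller) Py with anySubset? (λ D → D ⊂? y ×-dec P? D)
    ... | yes (D , D⊂y , PD) =
      let C , C-minimal , C⊆D = descend D (smaller D⊂y) PD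
      in  C , C-minimal , ⊆-trans C⊆D (p⊂q⇒p⊆q D⊂y)
    ... | no none = y , (Py , λ D PD D⊆y → ⊆∧⊄⇒≡ D⊆y (λ D⊂y → none (D , D⊂y , PD))) , ⊆-refl

module BinaryFromSubspace {s} (W : Subset s → Set) (W? : Decidable W)
                          (W-⊕ : ∀ {A B} → W A → W B → W (A ⊕ B)) where

  NonzeroW : Subset s → Set
  NonzeroW z = W z × z ≢ ⊥

  IsMinimal : Subset s → Set
  IsMinimal = MinimalWith NonzeroW

  circuit-below : ∀ {y} → NonzeroW y → ∃ λ C → IsMinimal C × C ⊆ y
  circuit-below = minimal-below (λ z → W? z ×-dec ¬? (z ≟ˢ ⊥))

  -- Circuit elimination: a circuit inside A ⊕ B avoids the common element x.
  elimination : ∀ {A B x} → IsMinimal A → IsMinimal B → A ≢ B → x ∈ A → x ∈ B →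
                ∃ λ C → IsMinimal C × C ⊆ (A ∪ B) - x
  elimination ((WA , _) , _) ((WB , _) , _) A≢B x∈A x∈B =
    let C , C-minimal , C⊆A⊕B = circuit-below (W-⊕ WA WB , A≢B ∘ ⊕≡⊥⇒≡)
    in  C , C-minimal , ⊆-trans C⊆A⊕B (⊕⊆∪-minus x∈A x∈B)

  matroid : Matroid s
  matroid = record
    { IsCircuit = IsMinimal
    ; nonempty  = λ ((_ , ⊥≢⊥) , _) → ⊥≢⊥ refl
    ; minimal   = λ minA minB A⊆B → proj₂ minB _ (proj₁ minA) A⊆B
    ; elim      = elimination
    }

  -- Every member of W is a disjoint union of circuits: split off a circuit
  -- C ⊆ y and decompose the rest y ─ C = y ⊕ C, which again lies in W.
  decompose : ∀ y → Acc _⊂_ y → W y → UnionOfDisjointCircuits matroid y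
  decompose y (acc smaller) Wy with y ≟ˢ ⊥
  ... | yes refl = [] , [] , [] , refl
  ... | no y≢⊥ =
    let C , C-minimal , C⊆y = circuit-below (Wy , y≢⊥)
        (WC , C≢⊥) , _ = C-minimal
        x , x∈C = ≢⊥⇒nonempty C≢⊥
        rest⊂y = p∩q≢∅⇒p─q⊂p y C (x , x∈p∩q⁺ (C⊆y x∈C , x∈C))
        W-rest = subst W (sym (─≡⊕ C⊆y)) (W-⊕ Wy WC)
    in  add-circuit C-minimal C⊆y (decompose (y ─ C) (smaller rest⊂y) W-rest)
    where
      add-circuit : ∀ {C} → IsMinimal C → C ⊆ y → UnionOfDisjointCircuits matroid (y ─ C) →
                    UnionOfDisjointCircuits matroid y
      add-circuit {C} C-minimal C⊆y (Ds , circuits , disjoint , rest≡⋃Ds) =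
        C ∷ Ds , C-minimal ∷ circuits ,
        All.map disjoint-from-C (⋃-upper Ds) ∷ disjoint ,
        trans (∪─-split C⊆y) (cong (C ∪_) rest≡⋃Ds)
        where
          disjoint-from-C : ∀ {Y} → Y ⊆ ⋃ Ds → C ∩ Y ≡ ⊥
          disjoint-from-C Y⊆⋃Ds = ─-disjoint λ x∈Y → subst (_ ∈_) (sym rest≡⋃Ds) (Y⊆⋃Ds x∈Y)

  binary : IsBinary matroid
  binary ((WA , _) , _) ((WB , _) , _) = decompose _ (⊂-wellFounded _) (W-⊕ WA WB)

next-step : ∀ {K} {i : Fin (suc K)} → toℕ i < K → toℕ (next i) ≡ suc (toℕ i)
next-step {K} {i} i<K with suc (toℕ i) ℕ.<? suc K
... | yes i+1<K+1 = toℕ-fromℕ< i+1<K+1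
... | no  i+1≮K+1 = contradiction (s≤s i<K) i+1≮K+1

next-wrap : ∀ {K} {i : Fin (suc K)} → toℕ i ≡ K → next i ≡ Fin.zero
next-wrap {K} {i} i≡K with suc (toℕ i) ℕ.<? suc K
... | yes i+1<K+1 = contradiction i≡K (ℕ.<⇒≢ (ℕ.≤-pred i+1<K+1))
... | no  _       = refl

data NextView {K} (i : Fin (suc K)) : Set where
  step-up : toℕ i < K → toℕ (next i) ≡ suc (toℕ i) → NextView i
  wrap    : toℕ i ≡ K → next i ≡ Fin.zero → NextView i

nextView : ∀ {K} (i : Fin (suc K)) → NextView i
nextView i with ℕ.m≤n⇒m<n∨m≡n (ℕ.≤-pred (toℕ<n i))
... | inj₁ i<K = step-up i<K (next-step i<K)
... | inj₂ i≡K = wrap i≡K (next-wrap i≡K)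

next-injective : ∀ {K} {i j : Fin (suc K)} → next i ≡ next j → i ≡ j
next-injective {i = i} {j} eq with nextView i | nextView j
... | step-up _ ↑i | step-up _ ↑j = toℕ-injective (ℕ.suc-injective (trans (sym ↑i) (trans (cong toℕ eq) ↑j)))
... | step-up _ ↑i | wrap _ ↺j    = contradiction (trans (sym ↑i) (trans (cong toℕ eq) (cong toℕ ↺j))) λ ()
... | wrap _ ↺i    | step-up _ ↑j = contradiction (trans (sym (cong toℕ ↺i)) (trans (cong toℕ eq) ↑j)) λ ()
... | wrap i≡K _   | wrap j≡K _   = toℕ-injective (trans i≡K (sym j≡K))

next-≢ : ∀ {K} → 0 < K → (i : Fin (suc K)) → next i ≢ i
next-≢ K>0 i eq with nextView i
... | step-up _ ↑i = ℕ.1+n≢n (trans (sym ↑i) (cong toℕ eq))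
... | wrap i≡K ↺i  = ℕ.>⇒≢ K>0 (trans (sym i≡K) (cong toℕ (trans (sym eq) ↺i)))

next²-≢ : ∀ {K} → 2 ≤ K → (i : Fin (suc K)) → next (next i) ≢ i
next²-≢ {K} K≥2 i eq with nextView i | nextView (next i)
... | step-up _ ↑i | step-up _ ↑i′ =
  ℕ.m≢1+n+m (toℕ i) (trans (sym (cong toℕ eq)) (trans ↑i′ (cong suc ↑i)))
... | step-up _ ↑i | wrap i′≡K ↺i′ =
  ℕ.>⇒≢ K≥2 (trans (sym i′≡K) (trans ↑i (cong (suc ∘ toℕ) (trans (sym eq) ↺i′))))
... | wrap i≡K ↺i  | step-up _ ↑i′ =
  ℕ.>⇒≢ K≥2 (trans (sym i≡K) (trans (sym (cong toℕ eq)) (trans ↑i′ (cong (suc ∘ toℕ) ↺i))))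
... | wrap _ ↺i    | wrap i′≡K _   =
  ℕ.>⇒≢ (ℕ.<-≤-trans z<s K≥2) (trans (sym i′≡K) (cong toℕ ↺i))

walk-around : ∀ {K} (P : Fin (suc K) → Set) → (∀ i → P i → P (next i)) →
              ∀ {i₀} → P i₀ → ∀ j → P j
walk-around {K} P closed {i₀} P-i₀ j = walk (toℕ j) Fin.zero j refl P-zero
  where
    walk : ∀ d i j → toℕ j ≡ toℕ i + d → P i → P j
    walk zero    i j j≡i   P-i = subst P (sym (toℕ-injective (trans j≡i (ℕ.+-identityʳ (toℕ i))))) P-i
    walk (suc d) i j j≡i+d P-i = walk d (next i) j j≡i′+d (closed i P-i)
      where
        i<K : toℕ i < K
        i<K = ℕ.<-≤-trans (ℕ.m<m+n (toℕ i) (s≤s z≤n)) (subst (_≤ K) j≡i+d (ℕ.≤-pred (toℕ<n j)))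
        j≡i′+d : toℕ j ≡ toℕ (next i) + d
        j≡i′+d = trans j≡i+d (trans (ℕ.+-suc (toℕ i) d) (cong (_+ d) (sym (next-step i<K))))
    P-last : P (fromℕ K)
    P-last = walk (K ∸ toℕ i₀) i₀ (fromℕ K)
                  (trans (toℕ-fromℕ K) (sym (ℕ.m+[n∸m]≡n (ℕ.≤-pred (toℕ<n i₀))))) P-i₀
    P-zero : P Fin.zero
    P-zero = subst P (next-wrap (toℕ-fromℕ K)) (closed (fromℕ K) P-last)

next-surjective : ∀ {K} (j : Fin (suc K)) → ∃ λ i → next i ≡ j
next-surjective = walk-around (λ j → ∃ λ i → next i ≡ j) (λ i _ → i , refl) {next Fin.zero} (Fin.zero , refl)

∃-function? : ∀ {a b} (P : (Fin a → Fin b) → Set) → (∀ {f g} → f ≗ g → P f → P g) →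
              Decidable P → Dec (∃ P)
∃-function? P resp P? =
  map′ (λ (i , P-i) → finToFun i , P-i)
       (λ (f , P-f) → funToFin f , resp (sym ∘ finToFun-funToFin f) P-f)
       (any? (P? ∘ finToFun))

injective? : ∀ {a b} (f : Fin a → Fin b) → Dec (Injective _≡_ _≡_ f)
injective? f =
  map′ (λ inj {i} {j} → inj i j) (λ inj i j → inj)
       (all? λ i → all? λ j → (f i ≟ f j) →-dec (i ≟ j))

module Boundaries {N} (G : Graph N) where

  -- The vertex set {a, b} (empty when a = b): the boundary of an edge ab.
  pair : Fin N → Fin N → Subset N
  pair a b = ⁅ a ⁆ ⊕ ⁅ b ⁆

  ends : Fin (m G) → Subset N
  ends e = pair (src G e) (tgt G e)

  incident : Subset (m G) → Fin N → Fin (m G) → Bool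
  incident y u e = lookup y e ∧ lookup (ends e) u

  ∂ : Subset (m G) → Subset N
  ∂ y = tabulate λ u → sum (incident y u)

  lookup-∂ : ∀ y u → lookup (∂ y) u ≡ sum (incident y u)
  lookup-∂ y u = lookup∘tabulate (λ u → sum (incident y u)) u

  lookup-pair : ∀ a b u → lookup (pair a b) u ≡ (a == u) xor (b == u)
  lookup-pair a b u = trans (lookup-⊕ ⁅ a ⁆ ⁅ b ⁆ u) (cong₂ _xor_ (lookup-⁅⁆ a u) (lookup-⁅⁆ b u))

  ∂-⊕ : ∀ y z → ∂ (y ⊕ z) ≡ ∂ y ⊕ ∂ z
  ∂-⊕ y z = subset-ext λ u → begin
    lookup (∂ (y ⊕ z)) u                            ≡⟨ lookup-∂ (y ⊕ z) u ⟩
    sum (incident (y ⊕ z) u)                        ≡⟨ sum-cong-≗ (incident-⊕ u) ⟩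
    sum (λ e → incident y u e xor incident z u e)   ≡⟨ ∑-distrib-+ (incident y u) (incident z u) ⟩
    sum (incident y u) xor sum (incident z u)       ≡⟨ cong₂ _xor_ (lookup-∂ y u) (lookup-∂ z u) ⟨
    lookup (∂ y) u xor lookup (∂ z) u               ≡⟨ lookup-⊕ (∂ y) (∂ z) u ⟨
    lookup (∂ y ⊕ ∂ z) u                            ∎
    where
      incident-⊕ : ∀ u e → incident (y ⊕ z) u e ≡ incident y u e xor incident z u e
      incident-⊕ u e = trans (cong (_∧ lookup (ends e) u) (lookup-⊕ y z e))
                             (∧-distribʳ-xor (lookup (ends e) u) (lookup y e) (lookup z e))

  ∂-sum : ∀ {A B X Y} → ∂ A ≡ X → ∂ B ≡ Y → ∂ (A ⊕ B) ≡ X ⊕ Y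
  ∂-sum {A} {B} ∂A≡X ∂B≡Y = trans (∂-⊕ A B) (cong₂ _⊕_ ∂A≡X ∂B≡Y)

  ∂-⊥ : ∂ ⊥ ≡ ⊥
  ∂-⊥ = subset-ext λ u →
    trans (lookup-∂ ⊥ u) (trans (Σ-zero _ (λ e → cong (_∧ lookup (ends e) u) (lookup-⊥ e))) (sym (lookup-⊥ u)))

  ∂-⁅⁆ : ∀ e → ∂ ⁅ e ⁆ ≡ ends e
  ∂-⁅⁆ e = subset-ext λ u → begin
    lookup (∂ ⁅ e ⁆) u                                ≡⟨ lookup-∂ ⁅ e ⁆ u ⟩
    sum (incident ⁅ e ⁆ u)                            ≡⟨ Σ-single _ e (λ i i≢e → cong (_∧ lookup (ends i) u) (off i i≢e)) ⟩
    lookup ⁅ e ⁆ e ∧ lookup (ends e) u                ≡⟨ cong (_∧ lookup (ends e) u) (∈⇒true (x∈⁅x⁆ e)) ⟩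
    lookup (ends e) u                                 ∎
    where
      off : ∀ i → i ≢ e → lookup ⁅ e ⁆ i ≡ false
      off i i≢e = ∉⇒false (i≢e ∘ x∈⁅y⁆⇒x≡y e)

  pair-self : ∀ a → pair a a ≡ ⊥
  pair-self a = ⊕-self ⁅ a ⁆

  pair-comm : ∀ a b → pair a b ≡ pair b a
  pair-comm a b = ⊕-comm ⁅ a ⁆ ⁅ b ⁆

  pair-trans : ∀ a b c → pair a b ⊕ pair b c ≡ pair a c
  pair-trans a b c = begin
    (⁅ a ⁆ ⊕ ⁅ b ⁆) ⊕ (⁅ b ⁆ ⊕ ⁅ c ⁆)  ≡⟨ ⊕-assoc ⁅ a ⁆ ⁅ b ⁆ (⁅ b ⁆ ⊕ ⁅ c ⁆) ⟩
    ⁅ a ⁆ ⊕ (⁅ b ⁆ ⊕ (⁅ b ⁆ ⊕ ⁅ c ⁆))  ≡⟨ cong (⁅ a ⁆ ⊕_) (⊕-assoc ⁅ b ⁆ ⁅ b ⁆ ⁅ c ⁆) ⟨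
    ⁅ a ⁆ ⊕ ((⁅ b ⁆ ⊕ ⁅ b ⁆) ⊕ ⁅ c ⁆)  ≡⟨ cong (λ X → ⁅ a ⁆ ⊕ (X ⊕ ⁅ c ⁆)) (⊕-self ⁅ b ⁆) ⟩
    ⁅ a ⁆ ⊕ (⊥ ⊕ ⁅ c ⁆)                ≡⟨ cong (⁅ a ⁆ ⊕_) (⊕-identityˡ ⁅ c ⁆) ⟩
    ⁅ a ⁆ ⊕ ⁅ c ⁆                      ∎

  Joins⇒ends : ∀ {e a b} → Joins G e a b → ends e ≡ pair a b
  Joins⇒ends (inj₁ (refl , refl)) = refl
  Joins⇒ends (inj₂ (refl , refl)) = pair-comm _ _

  Joins-unique : ∀ {e e′ a b} → Joins G e a b → Joins G e′ a b → e ≡ e′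
  Joins-unique {e} {e′} (inj₁ (refl , refl)) e′-joins = simple G e e′ e′-joins
  Joins-unique {e} {e′} (inj₂ (refl , refl)) e′-joins = simple G e e′ (swap e′-joins)

  Boundary : Subset N → Set
  Boundary T = ∃ λ y → ∂ y ≡ T

  boundary-⊕ : ∀ {A B} → Boundary A → Boundary B → Boundary (A ⊕ B)
  boundary-⊕ (y , ∂y≡A) (z , ∂z≡B) = y ⊕ z , ∂-sum {y} {z} ∂y≡A ∂z≡B

  boundary-⨁ : ∀ {a} (F : Fin a → Subset N) → (∀ i → Boundary (F i)) → Boundary (⨁ F)
  boundary-⨁ {zero}  F _      = ⊥ , ∂-⊥
  boundary-⨁ {suc a} F bounds = boundary-⊕ (bounds Fin.zero) (boundary-⨁ (F ∘ Fin.suc) (bounds ∘ Fin.suc))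

  Linked : Fin N → Fin N → Set
  Linked u w = Boundary (pair u w)

  linked-refl : ∀ u → Linked u u
  linked-refl u = ⊥ , trans ∂-⊥ (sym (pair-self u))

  linked-sym : ∀ {u w} → Linked u w → Linked w u
  linked-sym {u} {w} (y , ∂y≡uw) = y , trans ∂y≡uw (pair-comm u w)

  linked-trans : ∀ {u w x} → Linked u w → Linked w x → Linked u x
  linked-trans {u} {w} {x} uw wx = subst Boundary (pair-trans u w x) (boundary-⊕ uw wx)

  linked-edge : ∀ {e a b} → Joins G e a b → Linked a b
  linked-edge {e} e-joins = ⁅ e ⁆ , trans (∂-⁅⁆ e) (Joins⇒ends e-joins)

  module OnCycle (c : Circ G) where

    edge : Fin (suc (k c)) → Fin (m G)
    edge i = proj₁ (step c i)

    edge-joins : ∀ i → Joins G (edge i) (v c i) (v c (next i))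
    edge-joins i = proj₂ (step c i)

    prev : Fin (suc (k c)) → Fin (suc (k c))
    prev j = proj₁ (next-surjective j)

    next-prev : ∀ j → next (prev j) ≡ j
    next-prev j = proj₂ (next-surjective j)

    v-== : ∀ i j → (v c i == v c j) ≡ (i == j)
    v-== i j with i ≟ j
    ... | yes refl = dec-true (v c i ≟ v c i) refl
    ... | no  i≢j  = dec-false (v c i ≟ v c j) (i≢j ∘ v-inj c)

    edge-at-vertex : ∀ i j → lookup (ends (edge i)) (v c j) ≡ (i == j) xor (next i == j)
    edge-at-vertex i j = begin
      lookup (ends (edge i)) (v c j)                     ≡⟨ cong (λ X → lookup X (v c j)) (Joins⇒ends (edge-joins i)) ⟩
      lookup (pair (v c i) (v c (next i))) (v c j)       ≡⟨ lookup-pair (v c i) (v c (next i)) (v c j) ⟩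
      (v c i == v c j) xor (v c (next i) == v c j)       ≡⟨ cong₂ _xor_ (v-== i j) (v-== (next i) j) ⟩
      (i == j) xor (next i == j)                         ∎

    edge-off-cycle : ∀ {u} → (∀ j → v c j ≢ u) → ∀ i → lookup (ends (edge i)) u ≡ false
    edge-off-cycle {u} off i =
      trans (cong (λ X → lookup X u) (Joins⇒ends (edge-joins i)))
            (trans (lookup-pair (v c i) (v c (next i)) u)
                   (cong₂ _xor_ (dec-false (v c i ≟ u) (off i)) (dec-false (v c (next i) ≟ u) (off (next i)))))

    k>0 : 0 < k c
    k>0 = ℕ.<-≤-trans z<s (long c)

    j≢next-j : ∀ j → j ≢ next j
    j≢next-j j = next-≢ k>0 j ∘ sym

    edge-at-tail : ∀ i → lookup (ends (edge i)) (v c i) ≡ true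
    edge-at-tail i = trans (edge-at-vertex i i) (cong₂ _xor_ (==-refl i) (dec-false (next i ≟ i) (next-≢ k>0 i)))

    edge-at-head : ∀ i → lookup (ends (edge i)) (v c (next i)) ≡ true
    edge-at-head i = trans (edge-at-vertex i (next i)) (cong₂ _xor_ (dec-false (i ≟ next i) (j≢next-j i)) (==-refl (next i)))

    edge-elsewhere : ∀ {i j} → i ≢ j → next i ≢ j → lookup (ends (edge i)) (v c j) ≡ false
    edge-elsewhere {i} {j} i≢j next-i≢j =
      trans (edge-at-vertex i j) (cong₂ _xor_ (dec-false (i ≟ j) i≢j) (dec-false (next i ≟ j) next-i≢j))

    -- The edges leaving and entering v c j are distinct, since only the first
    -- is incident to v c (next j): the cycle has at least three vertices.
    edge-prev-≢ : ∀ j → edge j ≢ edge (prev j)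
    edge-prev-≢ j same = contradiction (begin
      true                                           ≡⟨ edge-at-head j ⟨
      lookup (ends (edge j)) (v c (next j))          ≡⟨ cong (λ e → lookup (ends e) (v c (next j))) same ⟩
      lookup (ends (edge (prev j))) (v c (next j))   ≡⟨ edge-elsewhere prev≢next (j≢next-j j ∘ trans (sym (next-prev j))) ⟩
      false                                          ∎) λ ()
      where
        prev≢next : prev j ≢ next j
        prev≢next p≡n = next²-≢ (long c) j (trans (cong next (sym p≡n)) (next-prev j))

    UsesCycleEdges : Subset (m G) → Set
    UsesCycleEdges z = ∀ {e} → e ∈ z → ∃ λ i → e ≡ edge i

    ∂-at-vertex : ∀ {z} → UsesCycleEdges z → ∀ j →
                  lookup (∂ z) (v c j) ≡ lookup z (edge j) xor lookup z (edge (prev j))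
    ∂-at-vertex {z} cyclic j = begin
      lookup (∂ z) (v c j)                               ≡⟨ lookup-∂ z (v c j) ⟩
      sum (incident z (v c j))                           ≡⟨ Σ-pair (incident z (v c j)) (edge-prev-≢ j) off ⟩
      incident z (v c j) (edge j) xor incident z (v c j) (edge (prev j))
                                                         ≡⟨ cong₂ _xor_ (counts (edge-at-tail j)) (counts entering) ⟩
      lookup z (edge j) xor lookup z (edge (prev j))     ∎
      where
        counts : ∀ {e} → lookup (ends e) (v c j) ≡ true → incident z (v c j) e ≡ lookup z e
        counts {e} e∋vj = trans (cong (lookup z e ∧_) e∋vj) (∧-identityʳ (lookup z e))
        entering : lookup (ends (edge (prev j))) (v c j) ≡ true
        entering = subst (λ t → lookup (ends (edge (prev j))) (v c t) ≡ true) (next-prev j) (edge-at-head (prev j))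
        off : ∀ e → e ≢ edge j → e ≢ edge (prev j) → incident z (v c j) e ≡ false
        off e e≢leaving e≢entering with lookup z e in z∋e
        ... | false = refl
        ... | true with cyclic (true⇒∈ z∋e)
        ...   | i , refl = edge-elsewhere (e≢leaving ∘ cong edge)
                  λ next-i≡j → e≢entering (cong edge (next-injective (trans next-i≡j (sym (next-prev j)))))

    ∂-off-cycle : ∀ {z} → UsesCycleEdges z → ∀ {u} → (∀ j → v c j ≢ u) → lookup (∂ z) u ≡ false
    ∂-off-cycle {z} cyclic {u} off = trans (lookup-∂ z u) (Σ-zero _ vanish)
      where
        vanish : ∀ e → incident z u e ≡ false
        vanish e with lookup z e in z∋e
        ... | false = refl
        ... | true with cyclic (true⇒∈ z∋e)
        ...   | i , refl = edge-off-cycle off i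

    ∂-on-cycle : ∀ {z} → UsesCycleEdges z → ∀ {u} → u ∈ ∂ z → ∃ λ i → v c i ≡ u
    ∂-on-cycle cyclic {u} u∈∂z with any? (λ i → v c i ≟ u)
    ... | yes on-cycle = on-cycle
    ... | no  off      = contradiction (trans (sym (∂-off-cycle cyclic λ i vi≡u → off (i , vi≡u))) (∈⇒true u∈∂z)) λ ()

    linked-on-cycle : ∀ i j → Linked (v c i) (v c j)
    linked-on-cycle i = walk-around (λ t → Linked (v c i) (v c t))
                                    (λ t i~t → linked-trans i~t (linked-edge (edge-joins t)))
                                    (linked-refl (v c i))

  module CycleEdgeSet (c : Circ G) (C : Subset (m G)) (C-edges : ∀ e → e ∈ C ⇔ InEdges c e) where
    open OnCycle c

    ⊆C⇒cyclic : ∀ {z} → z ⊆ C → UsesCycleEdges z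
    ⊆C⇒cyclic z⊆C e∈z =
      let i , e-joins = Equivalence.to (C-edges _) (z⊆C e∈z)
      in  i , Joins-unique e-joins (edge-joins i)

    edge∈C : ∀ i → edge i ∈ C
    edge∈C i = Equivalence.from (C-edges (edge i)) (i , edge-joins i)

    ∂C≡⊥ : ∂ C ≡ ⊥
    ∂C≡⊥ = subset-ext degree
      where
        degree : ∀ u → lookup (∂ C) u ≡ lookup ⊥ u
        degree u with any? (λ i → v c i ≟ u)
        ... | yes (j , refl) = begin
          lookup (∂ C) (v c j)                           ≡⟨ ∂-at-vertex (⊆C⇒cyclic id) j ⟩
          lookup C (edge j) xor lookup C (edge (prev j))  ≡⟨ cong₂ _xor_ (∈⇒true (edge∈C j)) (∈⇒true (edge∈C (prev j))) ⟩
          false                                          ≡⟨ lookup-⊥ (v c j) ⟨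
          lookup ⊥ (v c j)                               ∎
        ... | no off = trans (∂-off-cycle (⊆C⇒cyclic id) λ i vi≡u → off (i , vi≡u)) (sym (lookup-⊥ u))

    C≢⊥ : C ≢ ⊥
    C≢⊥ C≡⊥ = ∉⊥ (subst (edge Fin.zero ∈_) C≡⊥ (edge∈C Fin.zero))

    -- A nonempty edge set z ⊆ C without boundary is all of C: the edges of z
    -- at a vertex of the cycle come in pairs, so z propagates around the cycle.
    cycle-minimal : ∀ {z} → z ⊆ C → ∂ z ≡ ⊥ → z ≢ ⊥ → z ≡ C
    cycle-minimal {z} z⊆C ∂z≡⊥ z≢⊥ = ⊆-antisym z⊆C C⊆z
      where
        propagate : ∀ t → edge t ∈ z → edge (next t) ∈ z
        propagate t edge-t∈z = true⇒∈ (begin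
          lookup z (edge (next t))                       ≡⟨ xor-false⇒≡ no-boundary ⟩
          lookup z (edge (prev (next t)))                ≡⟨ cong (lookup z ∘ edge) (next-injective (next-prev (next t))) ⟩
          lookup z (edge t)                              ≡⟨ ∈⇒true edge-t∈z ⟩
          true                                           ∎)
          where
            no-boundary : lookup z (edge (next t)) xor lookup z (edge (prev (next t))) ≡ false
            no-boundary = trans (sym (∂-at-vertex (⊆C⇒cyclic z⊆C) (next t)))
                                (trans (cong (λ X → lookup X (v c (next t))) ∂z≡⊥) (lookup-⊥ (v c (next t))))
        C⊆z : C ⊆ z
        C⊆z e∈C =
          let e₀ , e₀∈z = ≢⊥⇒nonempty z≢⊥
              _  , e₀≡edge = ⊆C⇒cyclic z⊆C e₀∈z
              i  , e≡edge  = ⊆C⇒cyclic id e∈C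
          in  subst (_∈ z) (sym e≡edge)
                (walk-around (λ t → edge t ∈ z) propagate (subst (_∈ z) e₀≡edge e₀∈z) i)

  Covers : Circ G → Subset N → Set
  Covers c T = ∀ x → x ∈ T → ∃ λ i → v c i ≡ x

  joins? : ∀ e a b → Dec (Joins G e a b)
  joins? e a b = ((src G e ≟ a) ×-dec (tgt G e ≟ b)) ⊎-dec ((src G e ≟ b) ×-dec (tgt G e ≟ a))

  -- Whether some circuit covers T is decidable: a circuit is an injective
  -- cyclic sequence of at most N vertices, so there are finitely many candidates.
  covering? : ∀ T → Dec (∃ λ c → Covers c T)
  covering? T =
    map′ to-circuit from-circuit
         (ℕ.anyUpTo? (λ K → (2 ℕ.≤? K) ×-dec ∃-function? (CyclicCover K) respects (cyclic-cover? K)) N)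
    where
      CyclicCover : ∀ K → (Fin (suc K) → Fin N) → Set
      CyclicCover K f = Injective _≡_ _≡_ f × (∀ i → ∃ λ e → Joins G e (f i) (f (next i))) ×
                        (∀ x → x ∈ T → ∃ λ i → f i ≡ x)

      cyclic-cover? : ∀ K → Decidable (CyclicCover K)
      cyclic-cover? K f = injective? f
                          ×-dec all? (λ i → any? λ e → joins? e (f i) (f (next i)))
                          ×-dec all? (λ x → (x ∈? T) →-dec any? (λ i → f i ≟ x))

      respects : ∀ {K f g} → f ≗ g → CyclicCover K f → CyclicCover K g
      respects {f = f} {g} f≗g (injective , steps , cover) =
        (λ {i} {j} gi≡gj → injective (trans (f≗g i) (trans gi≡gj (sym (f≗g j))))) ,
        (λ i → let e , e-joins = steps i in e , subst₂ (Joins G e) (f≗g i) (f≗g (next i)) e-joins) ,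
        (λ x x∈T → let i , fi≡x = cover x x∈T in i , trans (sym (f≗g i)) fi≡x)

      to-circuit : (∃ λ K → K < N × 2 ≤ K × ∃ (CyclicCover K)) → ∃ λ c → Covers c T
      to-circuit (K , _ , K≥2 , f , injective , steps , cover) =
        record { k = K ; long = K≥2 ; v = f ; v-inj = injective ; step = steps } , cover

      from-circuit : (∃ λ c → Covers c T) → ∃ λ K → K < N × 2 ≤ K × ∃ (CyclicCover K)
      from-circuit (c , cover) = k c , injective⇒≤ (v-inj c) , long c , v c , v-inj c , step c , cover

  NoNontrivialBinaryInjection : Set₁
  NoNontrivialBinaryInjection =
    ∀ {s} (B : Matroid s) → IsBinary B → ¬ (∃ λ (ι : CircuitInjection G B) → Nontrivial ι)

  -- The edge sets with
  -- boundary ∅ or T form a ⊕-closed family; in its binary matroid every cycle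
  -- of G is a circuit, and so is a minimal edge set with boundary T, which is
  -- no cycle.  Hence the identity is a nontrivial circuit injection.
  module Uncovered {T : Subset N} (T-boundary : Boundary T) (T≢⊥ : T ≢ ⊥)
                   (uncovered : ¬ (∃ λ c → Covers c T)) where

    Relevant : Subset (m G) → Set
    Relevant z = ∂ z ≡ ⊥ ⊎ ∂ z ≡ T

    relevant? : Decidable Relevant
    relevant? z = (∂ z ≟ˢ ⊥) ⊎-dec (∂ z ≟ˢ T)

    relevant-⊕ : ∀ {A B} → Relevant A → Relevant B → Relevant (A ⊕ B)
    relevant-⊕ {A} {B} (inj₁ ∂A≡⊥) (inj₁ ∂B≡⊥) = inj₁ (trans (∂-sum {A} {B} ∂A≡⊥ ∂B≡⊥) (⊕-self ⊥))
    relevant-⊕ {A} {B} (inj₁ ∂A≡⊥) (inj₂ ∂B≡T) = inj₂ (trans (∂-sum {A} {B} ∂A≡⊥ ∂B≡T) (⊕-identityˡ T))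
    relevant-⊕ {A} {B} (inj₂ ∂A≡T) (inj₁ ∂B≡⊥) = inj₂ (trans (∂-sum {A} {B} ∂A≡T ∂B≡⊥) (⊕-identityʳ T))
    relevant-⊕ {A} {B} (inj₂ ∂A≡T) (inj₂ ∂B≡T) = inj₁ (trans (∂-sum {A} {B} ∂A≡T ∂B≡T) (⊕-self T))

    open BinaryFromSubspace Relevant relevant? (λ {A} {B} → relevant-⊕ {A} {B}) public

    -- A subset D of a cycle with ∂ D = T would put T on the cycle.
    cycle-circuit : ∀ {C} → IsGraphCircuit G C → IsMinimal C
    cycle-circuit {C} (c , C-edges) = (inj₁ ∂C≡⊥ , C≢⊥) , is-minimal
      where
        open OnCycle c
        open CycleEdgeSet c C C-edges
        is-minimal : ∀ D → NonzeroW D → D ⊆ C → D ≡ C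
        is-minimal D (inj₁ ∂D≡⊥ , D≢⊥) D⊆C = cycle-minimal D⊆C ∂D≡⊥ D≢⊥
        is-minimal D (inj₂ ∂D≡T , _)   D⊆C = contradiction
          (c , λ x x∈T → ∂-on-cycle (⊆C⇒cyclic D⊆C) (subst (x ∈_) (sym ∂D≡T) x∈T)) uncovered

    identity-injection : CircuitInjection G matroid
    identity-injection = record
      { f    = ⤖-id _
      ; maps = λ C C-cycle → C , ((λ _ → mk⇔ id id) , λ y _ → y , refl) , cycle-circuit C-cycle
      }

    -- A minimal T-join C is a circuit: if D ⊆ C had ∂ D = ∅, then C ─ D would
    -- be a smaller T-join.
    T-circuit : ∃ λ C → IsMinimal C × ∂ C ≡ T
    T-circuit with minimal-below (λ z → ∂ z ≟ˢ T) {y = proj₁ T-boundary} (proj₂ T-boundary)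
    ... | C , (∂C≡T , T-minimal) , _ = C , ((inj₂ ∂C≡T , C≢⊥) , is-minimal) , ∂C≡T
      where
        C≢⊥ : C ≢ ⊥
        C≢⊥ C≡⊥ = T≢⊥ (trans (sym ∂C≡T) (trans (cong ∂ C≡⊥) ∂-⊥))
        is-minimal : ∀ D → NonzeroW D → D ⊆ C → D ≡ C
        is-minimal D (inj₂ ∂D≡T , _)   D⊆C = T-minimal D ∂D≡T D⊆C
        is-minimal D (inj₁ ∂D≡⊥ , D≢⊥) D⊆C =
          contradiction (─-fixed⇒⊥ D⊆C (T-minimal (C ─ D) ∂[C─D]≡T (p─q⊆p C D))) D≢⊥
          where
            ∂[C─D]≡T : ∂ (C ─ D) ≡ T
            ∂[C─D]≡T = begin
              ∂ (C ─ D)  ≡⟨ cong ∂ (─≡⊕ D⊆C) ⟩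
              ∂ (C ⊕ D)  ≡⟨ ∂-sum {C} {D} ∂C≡T ∂D≡⊥ ⟩
              T ⊕ ⊥      ≡⟨ ⊕-identityʳ T ⟩
              T          ∎

    nontrivial : Nontrivial identity-injection
    nontrivial = let C , circuit , ∂C≡T = T-circuit in C , circuit , not-a-cycle ∂C≡T
      where
        not-a-cycle : ∀ {C} → ∂ C ≡ T → ¬ (∃ λ C′ → IsGraphCircuit G C′ × IsImage id C′ C)
        not-a-cycle {C} ∂C≡T (C′ , (c′ , C′-edges) , same , _) = T≢⊥ (begin
          T     ≡⟨ ∂C≡T ⟨
          ∂ C   ≡⟨ cong ∂ (⊆-antisym (Equivalence.from (same _)) (Equivalence.to (same _))) ⟩
          ∂ C′  ≡⟨ CycleEdgeSet.∂C≡⊥ c′ C′ C′-edges ⟩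
          ⊥     ∎)

  covered : NoNontrivialBinaryInjection → ∀ {T} → Boundary T → Nonempty T → ∃ λ c → Covers c T
  covered no-injection {T} T-boundary (x , x∈T) with covering? T
  ... | yes cover    = cover
  ... | no uncovered = contradiction (identity-injection , nontrivial) (no-injection matroid binary)
    where open Uncovered T-boundary (λ T≡⊥ → ∉⊥ (subst (x ∈_) T≡⊥ x∈T)) uncovered

  neighbour : NoIsolated G → ∀ u → ∃ λ e → ∃ λ a → a ≢ u × Joins G e u a
  neighbour no-isolated u with no-isolated u
  ... | e , inj₁ src≡u = e , tgt G e , (λ tgt≡u → loopless G e (trans src≡u (sym tgt≡u))) , inj₁ (src≡u , refl)
  ... | e , inj₂ tgt≡u = e , src G e , (λ src≡u → loopless G e (trans src≡u (sym tgt≡u))) , inj₂ (refl , tgt≡u)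

  ∈-pair⊕pair : ∀ {u a w b} → u ≢ a → u ≢ w → u ≢ b → u ∈ pair u a ⊕ pair w b
  ∈-pair⊕pair {u} {a} {w} {b} u≢a u≢w u≢b = true⇒∈ (begin
    lookup (pair u a ⊕ pair w b) u                        ≡⟨ lookup-⊕ (pair u a) (pair w b) u ⟩
    lookup (pair u a) u xor lookup (pair w b) u           ≡⟨ cong₂ _xor_ (lookup-pair u a u) (lookup-pair w b u) ⟩
    ((u == u) xor (a == u)) xor ((w == u) xor (b == u))   ≡⟨ cong₂ _xor_ (cong₂ _xor_ (==-refl u) (differ u≢a))
                                                                         (cong₂ _xor_ (differ u≢w) (differ u≢b)) ⟩
    true                                                  ∎)
    where
      differ : ∀ {x} → u ≢ x → (x == u) ≡ false
      differ {x} u≢x = dec-false (x ≟ u) (u≢x ∘ sym)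

  -- Under the hypothesis G is connected: all pairs of vertices are linked.
  -- With edges ua and wb, a circuit through {u, a} ⊕ {w, b} contains u and w.
  all-linked : NoNontrivialBinaryInjection → NoIsolated G → ∀ u w → Linked u w
  all-linked no-injection no-isolated u w
    with neighbour no-isolated u | neighbour no-isolated w
  ... | _ , a , a≢u , u–a | _ , b , b≢w , w–b with u ≟ w | w ≟ a | u ≟ b
  ... | yes refl | _        | _        = linked-refl u
  ... | no _     | yes refl | _        = linked-edge u–a
  ... | no _     | no _     | yes refl = linked-sym (linked-edge w–b)
  ... | no u≢w   | no w≢a   | no u≢b   =
    let T-boundary = boundary-⊕ (linked-edge u–a) (linked-edge w–b)
        u∈T = ∈-pair⊕pair (a≢u ∘ sym) u≢w u≢b
        w∈T = subst (w ∈_) (⊕-comm (pair w b) (pair u a)) (∈-pair⊕pair (b≢w ∘ sym) (u≢w ∘ sym) w≢a)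
        c , cover = covered no-injection T-boundary (u , u∈T)
        i , vi≡u = cover u u∈T
        j , vj≡w = cover w w∈T
    in  subst₂ Linked vi≡u vj≡w (OnCycle.linked-on-cycle c i j)

  pairsTo : Fin N → Subset N
  pairsTo w = ⨁ (λ u → pair u w)

  lookup-pairsTo : ∀ w x → lookup (pairsTo w) x ≡ true xor sum {N} (λ _ → w == x)
  lookup-pairsTo w x = begin
    lookup (pairsTo w) x                          ≡⟨ lookup-⨁ (λ u → pair u w) x ⟩
    sum {N} (λ u → lookup (pair u w) x)           ≡⟨ sum-cong-≗ (λ u → lookup-pair u w x) ⟩
    sum {N} (λ u → (u == x) xor (w == x))         ≡⟨ ∑-distrib-+ (_== x) (λ _ → w == x) ⟩
    sum {N} (_== x) xor sum {N} (λ _ → w == x)    ≡⟨ cong (_xor sum {N} (λ _ → w == x)) x-once ⟩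
    true xor sum {N} (λ _ → w == x)               ∎
    where
      x-once : sum {N} (_== x) ≡ true
      x-once = trans (Σ-single (_== x) x λ u → dec-false (u ≟ x)) (==-refl x)

  pairsTo-off : ∀ {w x} → x ≢ w → x ∈ pairsTo w
  pairsTo-off {w} {x} x≢w =
    true⇒∈ (trans (lookup-pairsTo w x) (cong (true xor_) (Σ-zero {N} (λ _ → w == x) λ _ → dec-false (w ≟ x) (x≢w ∘ sym))))

  pairsTo-even : ∀ {M} → N ≡ 2 * M → ∀ w x → x ∈ pairsTo w
  pairsTo-even {M} N≡2M w x =
    true⇒∈ (trans (lookup-pairsTo w x)
                  (cong (true xor_) (subst (λ n → sum {n} (λ _ → w == x) ≡ false) (sym N≡2M) (Σ-const-even M (w == x)))))

-- Lemma 2.2.  The circuit through pairsTo w misses at most w, whatever the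
-- parity of |G|; when |G| is even it misses nothing.
lemma2p2 : ∀ {n} (G : Graph (suc n)) → NoIsolated G →
    (∀ {s} (B : Matroid s) → IsBinary B → ¬ (∃ λ (ι : CircuitInjection G B) → Nontrivial ι)) →
    (∀ N → suc n ≡ 2 * N → Hamiltonian G) × (∀ N → suc n ≡ 2 * N + 1 → AlmostHamiltonian G)
lemma2p2 {n} G no-isolated no-injection = hamiltonian , λ _ _ → almost-hamiltonian
  where
    open Boundaries G

    -- Some circuit passes through all vertices of the boundary pairsTo w,
    -- which is nonempty as it contains a neighbour of w.
    circuit-through : ∀ w → ∃ λ c → Covers c (pairsTo w)
    circuit-through w =
      let _ , a , a≢w , _ = neighbour no-isolated w
      in  covered no-injection (boundary-⨁ (λ u → pair u w) λ u → all-linked no-injection no-isolated u w)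
                  (a , pairsTo-off a≢w)

    hamiltonian : ∀ N → suc n ≡ 2 * N → Hamiltonian G
    hamiltonian N even =
      let c , cover = circuit-through Fin.zero in c , λ u → cover u (pairsTo-even {N} even Fin.zero u)

    almost-hamiltonian : AlmostHamiltonian G
    almost-hamiltonian w = let c , cover = circuit-through w in c , λ u u≢w → cover u (pairsTo-off u≢w)
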